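{- Let $v=(v_1,\dots,v_m)$ be a tuple of positive integers. Let $\mathcal{S}_v$ be the class of nonempty words over $\{\mathcal{Z}_1,\dots,\mathcal{Z}_m\}$ whose letter counts $(n_1,\dots,n_m)$ are collinear to $v$, and $\mathcal{C}_v$ the class of nonempty necklaces (words up to cyclic rotation) over $\{\mathcal{Z}_1,\dots,\mathcal{Z}_m\}$ whose color counts are collinear to $v$, sizes being lengths. Then $\Theta\mathcal{C}_v$ is isomorphic (via a size-preserving bijection) to $\sum_{n>0}\varphi(n)\,\mathrm{Rep}_n(\mathcal{S}_v)$; equivalently, with $C_v$ and $S_v$ their generating functions, $xC_v'(x)=\sum_{n>0}\varphi(n)S_v(x^n)$.
   Context: $\varphi$ is Euler's totient function. For a class $\mathcal{A}$, the pointed class $\Theta\mathcal{A}$ is $\sum_{n>0}\mathcal{A}_n\times\{\epsilon_1,\dots,\epsilon_n\}$ with $\mathcal{A}_n$ the objects of size $n$ and the $\epsilon_i$ distinct size-$0$ objects (objects with a distinguished atom); its generating function is $xA'(x)$. $\mathrm{Rep}_n(\mathcal{A})=\{a\cdots a\ (n\text{ times}): a\in\mathcal{A}\}$, the $n$-fold concatenation having size $n|a|$; $\varphi(n)\mathcal{B}$ is a disjoint union of $\varphi(n)$ copies of $\mathcal{B}$, and $\sum$ is disjoint union. -}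

module Defs where

open import Level using (0ℓ)
open import Data.Nat using (ℕ; zero; suc; _+_; _*_; _<_)
open import Data.Nat.GCD using (gcd)
open import Data.Fin using (Fin)
open import Data.Fin.Properties using () renaming (_≟_ to _≟F_)
open import Data.List using (List; []; _∷_; _++_; [_]; length; filter; applyUpTo)
open import Data.Product using (Σ; ∃; _×_; _,_; proj₁; proj₂)
open import Relation.Binary using (Rel; IsEquivalence; Setoid)
open import Relation.Binary.PropositionalEquality as P using (_≡_)
open import Relation.Binary.Construct.Closure.Equivalence using (EqClosure)
import Relation.Binary.Construct.Closure.Equivalence as EC
open import Function.Bundles using (Bijection)
open import Data.Nat using (_≟_)

φ : ℕ → ℕ
φ n = length (filter (λ k → gcd k n ≟ 1) (applyUpTo suc n))

record Class : Set₁ where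
  field
    Obj   : Set
    _≈_   : Rel Obj 0ℓ
    isEq  : IsEquivalence _≈_
    size  : Obj → ℕ

  setoid : Setoid 0ℓ 0ℓ
  setoid = record { Carrier = Obj ; _≈_ = _≈_ ; isEquivalence = isEq }

open Class public

_≅_ : Class → Class → Set
A ≅ B = Σ (Bijection (setoid A) (setoid B))
          (λ f → ∀ x → size B (Bijection.to f x) ≡ size A x)

-- Pointing: Θ A = Σ_{n>0} A_n × {ε_1,…,ε_n}  (pointer index i < size)
Θ : Class → Class
Θ A = record
  { Obj  = Σ (Obj A) (λ a → Σ ℕ (λ i → i < size A a))
  ; _≈_  = λ { (a , i , _) (b , j , _) → _≈_ A a b × i ≡ j }
  ; isEq = record
      { refl  = IsEquivalence.refl (isEq A) , P.refl
      ; sym   = λ { (p , q) → IsEquivalence.sym (isEq A) p , P.sym q }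
      ; trans = λ { (p , q) (p' , q') →
                    IsEquivalence.trans (isEq A) p p' , P.trans q q' }
      }
  ; size = λ { (a , _) → size A a }
  }

-- Rep_n A = { a⋯a (n times) : a ∈ A }, represented by a, of size n·|a|
Rep : ℕ → Class → Class
Rep n A = record
  { Obj = Obj A ; _≈_ = _≈_ A ; isEq = isEq A
  ; size = λ a → n * size A a }

copies : ℕ → Class → Class
copies k A = record
  { Obj  = Fin k × Obj A
  ; _≈_  = λ { (i , a) (j , b) → i ≡ j × _≈_ A a b }
  ; isEq = record
      { refl  = P.refl , IsEquivalence.refl (isEq A)
      ; sym   = λ { (p , q) → P.sym p , IsEquivalence.sym (isEq A) q }
      ; trans = λ { (p , q) (p' , q') →
                    P.trans p p' , IsEquivalence.trans (isEq A) q q' }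
      }
  ; size = λ { (_ , a) → size A a }
  }

module _ (F : ℕ → Class) where
  SumObj : Set
  SumObj = Σ ℕ (λ n → 0 < n × Obj (F n))

  data SumEq : SumObj → SumObj → Set where
    inj : ∀ {n p q a b} → _≈_ (F n) a b → SumEq (n , p , a) (n , q , b)

  SumPos : Class
  SumPos = record
    { Obj  = SumObj
    ; _≈_  = SumEq
    ; isEq = record
        { refl  = λ { {n , p , a} → inj (IsEquivalence.refl (isEq (F n))) }
        ; sym   = λ { (inj {n} e) → inj (IsEquivalence.sym (isEq (F n)) e) }
        ; trans = λ { (inj {n} e) (inj e') →
                      inj (IsEquivalence.trans (isEq (F n)) e e') }
        }
    ; size = λ { (n , _ , a) → size (F n) a }
    }

count : ∀ {m} → List (Fin m) → Fin m → ℕ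
count w i = length (filter (_≟F i) w)

Collinear : ∀ {m} → (Fin m → ℕ) → (Fin m → ℕ) → Set
Collinear {m} c v = ∀ (i j : Fin m) → c i * v j ≡ c j * v i

GoodWord : ∀ {m} → (Fin m → ℕ) → Set
GoodWord {m} v = Σ (List (Fin m)) (λ w → 0 < length w × Collinear (count w) v)

Words : ∀ {m} → (Fin m → ℕ) → Class
Words v = record
  { Obj  = GoodWord v
  ; _≈_  = λ a b → proj₁ a ≡ proj₁ b
  ; isEq = record { refl = P.refl ; sym = P.sym ; trans = P.trans }
  ; size = λ a → length (proj₁ a)
  }

Rot1 : ∀ {A : Set} → List A → List A → Set
Rot1 {A} w w' = Σ A (λ x → Σ (List A) (λ xs → w ≡ x ∷ xs × w' ≡ xs ++ [ x ]))

Necklaces : ∀ {m} → (Fin m → ℕ) → Class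
Necklaces v = record
  { Obj  = GoodWord v
  ; _≈_  = EqClosure (λ a b → Rot1 (proj₁ a) (proj₁ b))
  ; isEq = EC.isEquivalence _
  ; size = λ a → length (proj₁ a)
  }

module Submission where

-- Every necklace has a canonical word (the rotation of least code
-- under an injective encoding of words into ℕ), and every word w is reached from
-- it by a least number of shifts, offset w.  The proof chains three size-
-- preserving isomorphisms through two intermediate classes:
--   1. (orbit–stabiliser) a pointed necklace (a, i) is the word t read from
--      position i together with the period i − offset t of t, so pointed
--      necklaces ≅ PeriodicWords (words with a marked period k < |w|);
--   2. a word w with period k is uⁿ with u the prefix of length
--      g = gcd(|w| − k, |w|), n = |w|/g, and j = (|w| − k)/g a totative of n;
--      conversely (n, j, u) gives uⁿ with period (n − j)·|u|, so
--      PeriodicWords ≅ TotativePowers;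
--   3. the totatives of n are enumerated by Fin (φ n).

open import Defs
open import Level using (0ℓ)
open import Data.Nat using (ℕ; zero; suc; pred; _+_; _*_; _∸_; _≤_; _<_; z≤n; z<s; NonZero; >-nonZero; _≤?_; _≟_)
open import Data.Nat.Properties
open import Data.Nat.DivMod using (_%_; _/_; m≡m%n+[m/n]*n; [m+kn]%n≡m%n; m<n⇒m%n≡m; m%n<n)
open import Data.Nat.Divisibility using (_∣_; ∣⇒≤)
open import Data.Nat.GCD using (gcd; gcd[m,n]∣m; gcd[m,n]∣n; gcd-GCD; gcd[m,n]≡0⇒n≡0; c*gcd[m,n]≡gcd[cm,cn]; module Bézout)
open import Data.Fin as Fin using (Fin; toℕ)
import Data.Fin.Properties as FinP
open import Data.List using (List; []; _∷_; _++_; [_]; length; filter; take; drop; applyUpTo; lookup)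
open import Data.List.Properties
open import Data.List.Relation.Unary.All as All using ()
open import Data.List.Relation.Unary.Any as Any using ()
open import Data.List.Relation.Unary.Any.Properties using (lookup-index)
open import Data.List.Relation.Unary.AllPairs using (_∷_)
open import Data.List.Relation.Unary.Unique.Propositional using (Unique)
import Data.List.Relation.Unary.Unique.Propositional.Properties as Unique
open import Data.List.Membership.Propositional.Properties using (∈-filter⁺; ∈-filter⁻; ∈-applyUpTo⁺; ∈-applyUpTo⁻; ∈-lookup)
open import Data.Product using (Σ; _×_; _,_; proj₁; proj₂)
open import Data.Sum using (_⊎_; inj₁; inj₂; [_,_]′)
open import Data.Empty using (⊥-elim)
open import Function using (_∘_)
open import Relation.Nullary using (¬_; yes; no)
open import Relation.Unary using (Decidable)
open import Relation.Binary using (Setoid; IsEquivalence)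
open import Relation.Binary.PropositionalEquality
  using (_≡_; refl; sym; trans; cong; cong₂; subst; subst₂; isEquivalence; module ≡-Reasoning)
import Relation.Binary.Construct.Closure.Equivalence as EqClosure
open import Function.Bundles using (Inverse; Bijection)
open import Function.Properties.Inverse using (Inverse⇒Bijection)
import Function.Construct.Composition as Compose

module _ {S T : Setoid 0ℓ 0ℓ} where
  private
    module S = Setoid S
    module T = Setoid T

  mkInverse : (to : S.Carrier → T.Carrier) (from : T.Carrier → S.Carrier) →
              (∀ {x y} → x S.≈ y → to x T.≈ to y) →
              (∀ {x y} → x T.≈ y → from x S.≈ from y) →
              (∀ y → to (from y) T.≈ y) → (∀ x → from (to x) S.≈ x) →
              Inverse S T
  mkInverse to from to-cong from-cong to∘from from∘to = record
    { to        = to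
    ; from      = from
    ; to-cong   = to-cong
    ; from-cong = from-cong
    ; inverse   = (λ {y} {x} x≈from-y → T.trans (to-cong x≈from-y) (to∘from y))
                , (λ {x} {y} y≈to-x → S.trans (from-cong y≈to-x) (from∘to x))
    }

mkIso : (A B : Class) (to : Obj A → Obj B) (from : Obj B → Obj A) →
        (∀ {x y} → _≈_ A x y → _≈_ B (to x) (to y)) →
        (∀ {x y} → _≈_ B x y → _≈_ A (from x) (from y)) →
        (∀ y → _≈_ B (to (from y)) y) → (∀ x → _≈_ A (from (to x)) x) →
        (∀ x → size B (to x) ≡ size A x) → A ≅ B
mkIso A B to from to-cong from-cong to∘from from∘to sizes =
  Inverse⇒Bijection (mkInverse {setoid A} {setoid B} to from to-cong from-cong to∘from from∘to)
  , sizes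

-- Size-preserving isomorphisms compose.  (The classes are explicit arguments
-- because _≅_ does not determine them by unification.)
≅-trans : ∀ A B C → A ≅ B → B ≅ C → A ≅ C
≅-trans A B C (f , f-size) (g , g-size) =
  Compose.bijection f g , λ x → trans (g-size (Bijection.to f x)) (f-size x)

module _ {A : Set} where

  rot1 : List A → List A
  rot1 []       = []
  rot1 (x ∷ xs) = xs ++ [ x ]

  rotate : ℕ → List A → List A
  rotate zero    w = w
  rotate (suc k) w = rotate k (rot1 w)

  rotate-+ : ∀ a b w → rotate (a + b) w ≡ rotate b (rotate a w)
  rotate-+ zero    b w = refl
  rotate-+ (suc a) b w = rotate-+ a b (rot1 w)

  rotate-++ : ∀ (xs ys : List A) → rotate (length xs) (xs ++ ys) ≡ ys ++ xs
  rotate-++ []       ys = sym (++-identityʳ ys)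
  rotate-++ (x ∷ xs) ys = begin
    rotate (length xs) ((xs ++ ys) ++ [ x ]) ≡⟨ cong (rotate (length xs)) (++-assoc xs ys [ x ]) ⟩
    rotate (length xs) (xs ++ ys ++ [ x ])   ≡⟨ rotate-++ xs (ys ++ [ x ]) ⟩
    (ys ++ [ x ]) ++ xs                      ≡⟨ ++-assoc ys [ x ] xs ⟩
    ys ++ x ∷ xs                             ∎
    where open ≡-Reasoning

  rotate-length : ∀ w → rotate (length w) w ≡ w
  rotate-length w = begin
    rotate (length w) w         ≡⟨ cong (rotate (length w)) (sym (++-identityʳ w)) ⟩
    rotate (length w) (w ++ []) ≡⟨ rotate-++ w [] ⟩
    w                           ∎
    where open ≡-Reasoning

  rotate-[] : ∀ k → rotate k [] ≡ []
  rotate-[] zero    = refl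
  rotate-[] (suc k) = rotate-[] k

  length-rot1 : ∀ w → length (rot1 w) ≡ length w
  length-rot1 []       = refl
  length-rot1 (x ∷ xs) = trans (length-++ xs) (+-comm (length xs) 1)

  length-rotate : ∀ k w → length (rotate k w) ≡ length w
  length-rotate zero    w = refl
  length-rotate (suc k) w = trans (length-rotate k (rot1 w)) (length-rot1 w)

  Period : List A → ℕ → Set
  Period w k = rotate k w ≡ w

  period-length : ∀ w → Period w (length w)
  period-length = rotate-length

  period-+ : ∀ {w a b} → Period w a → Period w b → Period w (a + b)
  period-+ {w} {a} {b} pa pb = trans (rotate-+ a b w) (trans (cong (rotate b) pa) pb)

  period-* : ∀ {w a} q → Period w a → Period w (q * a)
  period-* zero    pa = refl
  period-* {w} {a} (suc q) pa = period-+ {w} {a} {q * a} pa (period-* q pa)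

  period-∸ : ∀ {w a b} → b ≤ a → Period w a → Period w b → Period w (a ∸ b)
  period-∸ {w} {a} {b} b≤a pa pb = begin
    rotate (a ∸ b) w              ≡⟨ cong (rotate (a ∸ b)) (sym pb) ⟩
    rotate (a ∸ b) (rotate b w)   ≡⟨ sym (rotate-+ b (a ∸ b) w) ⟩
    rotate (b + (a ∸ b)) w        ≡⟨ cong (λ c → rotate c w) (m+[n∸m]≡n b≤a) ⟩
    rotate a w                    ≡⟨ pa ⟩
    w                             ∎
    where open ≡-Reasoning

  -- Periods form a subgroup of ℤ, hence contain the gcd (Bézout).
  period-gcd : ∀ {w} a b → Period w a → Period w b → Period w (gcd a b)
  period-gcd {w} a b pa pb with Bézout.identity (gcd-GCD a b)
  ... | Bézout.+- x y eq = subst (Period w) (m+n∸n≡m (gcd a b) (y * b))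
          (period-∸ (m≤n+m (y * b) (gcd a b)) (subst (Period w) (sym eq) (period-* x pa)) (period-* y pb))
  ... | Bézout.-+ x y eq = subst (Period w) (m+n∸n≡m (gcd a b) (x * a))
          (period-∸ (m≤n+m (x * a) (gcd a b)) (subst (Period w) (sym eq) (period-* y pb)) (period-* x pa))

  rotate-mod : ∀ a w .{{_ : NonZero (length w)}} → rotate a w ≡ rotate (a % length w) w
  rotate-mod a w = begin
    rotate a w                                  ≡⟨ cong (λ c → rotate c w) (trans (m≡m%n+[m/n]*n a N) (+-comm (a % N) _)) ⟩
    rotate ((a / N) * N + a % N) w              ≡⟨ rotate-+ ((a / N) * N) (a % N) w ⟩
    rotate (a % N) (rotate ((a / N) * N) w)     ≡⟨ cong (rotate (a % N)) (period-* (a / N) (period-length w)) ⟩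
    rotate (a % N) w                            ∎
    where
    open ≡-Reasoning
    N = length w

  power : ℕ → List A → List A
  power zero    u = []
  power (suc n) u = u ++ power n u

  length-power : ∀ n u → length (power n u) ≡ n * length u
  length-power zero    u = refl
  length-power (suc n) u = trans (length-++ u) (cong (length u +_) (length-power n u))

  power-comm : ∀ n u → power n u ++ u ≡ u ++ power n u
  power-comm zero    u = sym (++-identityʳ u)
  power-comm (suc n) u = trans (++-assoc u (power n u) u) (cong (u ++_) (power-comm n u))

  period-power : ∀ n u → Period (power n u) (length u)
  period-power zero    u = rotate-[] (length u)
  period-power (suc n) u = trans (rotate-++ u (power n u)) (power-comm n u)

  ++-cancel-prefix : ∀ (xs ys : List A) {zs ws} → length xs ≡ length ys →
                     xs ++ zs ≡ ys ++ ws → xs ≡ ys × zs ≡ ws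
  ++-cancel-prefix []       []       _ e = refl , e
  ++-cancel-prefix (x ∷ xs) (y ∷ ys) l e
    with ++-cancel-prefix xs ys (suc-injective l) (∷-injectiveʳ e)
  ... | xs≡ys , zs≡ws = cong₂ _∷_ (∷-injectiveˡ e) xs≡ys , zs≡ws

  take-++-length : ∀ (xs ys : List A) → take (length xs) (xs ++ ys) ≡ xs
  take-++-length []       ys = refl
  take-++-length (x ∷ xs) ys = cong (x ∷_) (take-++-length xs ys)

  take-power : ∀ n u → 0 < n → take (length u) (power n u) ≡ u
  take-power (suc n) u _ = take-++-length u (power n u)

  commuting⇒power : ∀ n u r → r ++ u ≡ u ++ r → length r ≡ n * length u → r ≡ power n u
  commuting⇒power zero    u []      _ _  = refl
  commuting⇒power (suc n) u r comm len = begin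
    r      ≡⟨ sym (take++drop≡id (length u) r) ⟩
    t ++ d ≡⟨ cong₂ _++_ t≡u (commuting⇒power n u d d-comm d-len) ⟩
    u ++ power n u ∎
    where
    open ≡-Reasoning
    t = take (length u) r
    d = drop (length u) r
    t-len : length t ≡ length u
    t-len = trans (length-take (length u) r)
                  (m≤n⇒m⊓n≡m (subst (length u ≤_) (sym len) (m≤m+n (length u) _)))
    split : t ++ (d ++ u) ≡ u ++ (t ++ d)
    split = trans (sym (++-assoc t d u))
                  (trans (cong (_++ u) (take++drop≡id (length u) r))
                         (trans comm (cong (u ++_) (sym (take++drop≡id (length u) r)))))
    t≡u : t ≡ u
    t≡u = proj₁ (++-cancel-prefix t u t-len split)
    d-comm : d ++ u ≡ u ++ d
    d-comm = trans (proj₂ (++-cancel-prefix t u t-len split)) (cong (_++ d) t≡u)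
    d-len : length d ≡ n * length u
    d-len = trans (length-drop (length u) r)
                  (trans (cong (_∸ length u) len) (m+n∸m≡n (length u) _))

  periodic⇒power : ∀ n g w → Period w g → n * g ≡ length w → w ≡ power n (take g w)
  periodic⇒power zero    g []      _   _   = refl
  periodic⇒power (suc n) g w   per len = begin
    w      ≡⟨ sym (take++drop≡id g w) ⟩
    t ++ d ≡⟨ cong (t ++_) (commuting⇒power n t d d-comm d-len) ⟩
    t ++ power n t ∎
    where
    open ≡-Reasoning
    t = take g w
    d = drop g w
    t-len : length t ≡ g
    t-len = trans (length-take g w) (m≤n⇒m⊓n≡m (subst (g ≤_) len (m≤m+n g (n * g))))
    d-comm : d ++ t ≡ t ++ d
    d-comm = begin
      d ++ t                     ≡⟨ sym (rotate-++ t d) ⟩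
      rotate (length t) (t ++ d) ≡⟨ cong₂ rotate t-len (take++drop≡id g w) ⟩
      rotate g w                 ≡⟨ per ⟩
      w                          ≡⟨ sym (take++drop≡id g w) ⟩
      t ++ d                     ∎
    d-len : length d ≡ n * length t
    d-len = begin
      length d       ≡⟨ length-drop g w ⟩
      length w ∸ g   ≡⟨ cong (_∸ g) (sym len) ⟩
      g + n * g ∸ g  ≡⟨ m+n∸m≡n g (n * g) ⟩
      n * g          ≡⟨ cong (n *_) (sym t-len) ⟩
      n * length t   ∎

≤-suc-cases : ∀ {b n} → b ≤ suc n → b ≤ n ⊎ b ≡ suc n
≤-suc-cases b≤1+n with m≤n⇒m<n∨m≡n b≤1+n
... | inj₁ b<1+n = inj₁ (≤-pred b<1+n)
... | inj₂ b≡1+n = inj₂ b≡1+n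

Least : (ℕ → Set) → ℕ → Set
Least P a = P a × (∀ b → b < a → ¬ P b)

least-≤ : ∀ {P a j} → Least P a → P j → a ≤ j
least-≤ (_ , below) pj = ≮⇒≥ (λ j<a → below _ j<a pj)

module _ {P : ℕ → Set} (P? : Decidable P) where

  searchBelow : ∀ n → (∀ b → b < n → ¬ P b) ⊎ Σ ℕ (Least P)
  searchBelow zero = inj₁ (λ _ ())
  searchBelow (suc n) with searchBelow n
  ... | inj₂ found = inj₂ found
  ... | inj₁ none with P? n
  ...   | yes pn = inj₂ (n , pn , none)
  ...   | no ¬pn = inj₁ λ b b<1+n →
            [ none b , (λ { refl → ¬pn }) ]′ (m≤n⇒m<n∨m≡n (≤-pred b<1+n))

  leastWitness : ∀ j → P j → Σ ℕ (Least P)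
  leastWitness j pj with searchBelow (suc j)
  ... | inj₁ none  = ⊥-elim (none j ≤-refl pj)
  ... | inj₂ found = found

minimiser : (f : ℕ → ℕ) (n : ℕ) → Σ ℕ λ a → a ≤ n × (∀ b → b ≤ n → f a ≤ f b)
minimiser f zero = zero , z≤n , λ { zero z≤n → ≤-refl }
minimiser f (suc n) with minimiser f n
... | a , a≤n , a-min with f a ≤? f (suc n)
...   | yes fa≤ = a , m≤n⇒m≤1+n a≤n , λ b b≤ →
          [ a-min b , (λ { refl → fa≤ }) ]′ (≤-suc-cases b≤)
...   | no fa≰ = suc n , ≤-refl , λ b b≤ →
          [ (λ b≤n → ≤-trans (<⇒≤ (≰⇒> fa≰)) (a-min b b≤n)) , (λ { refl → ≤-refl }) ]′ (≤-suc-cases b≤)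

count-++ : ∀ {m} (xs ys : List (Fin m)) i → count (xs ++ ys) i ≡ count xs i + count ys i
count-++ xs ys i = trans (cong length (filter-++ (FinP._≟ i) xs ys)) (length-++ (filter (FinP._≟ i) xs))

count-rot1 : ∀ {m} (w : List (Fin m)) i → count (rot1 w) i ≡ count w i
count-rot1 []       i = refl
count-rot1 (x ∷ xs) i = begin
  count (xs ++ [ x ]) i      ≡⟨ count-++ xs [ x ] i ⟩
  count xs i + count [ x ] i ≡⟨ +-comm (count xs i) (count [ x ] i) ⟩
  count [ x ] i + count xs i ≡⟨ sym (count-++ [ x ] xs i) ⟩
  count (x ∷ xs) i           ∎
  where open ≡-Reasoning

count-rotate : ∀ {m} k (w : List (Fin m)) i → count (rotate k w) i ≡ count w i
count-rotate zero    w i = refl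
count-rotate (suc k) w i = trans (count-rotate k (rot1 w) i) (count-rot1 w i)

count-power : ∀ {m} n (u : List (Fin m)) i → count (power n u) i ≡ n * count u i
count-power zero    u i = refl
count-power (suc n) u i = trans (count-++ u (power n u) i) (cong (count u i +_) (count-power n u i))

collinear-≗ : ∀ {m} {c c' v : Fin m → ℕ} → (∀ i → c' i ≡ c i) → Collinear c v → Collinear c' v
collinear-≗ {c = c} {c'} {v} c'≗c col i j =
  trans (cong (_* v j) (c'≗c i)) (trans (col i j) (cong (_* v i) (sym (c'≗c j))))

collinear-scale : ∀ {m} {c v : Fin m → ℕ} n → Collinear c v → Collinear (λ i → n * c i) v
collinear-scale {c = c} {v} n col i j = begin
  n * c i * v j   ≡⟨ *-assoc n (c i) (v j) ⟩
  n * (c i * v j) ≡⟨ cong (n *_) (col i j) ⟩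
  n * (c j * v i) ≡⟨ sym (*-assoc n (c j) (v i)) ⟩
  n * c j * v i   ∎
  where open ≡-Reasoning

collinear-unscale : ∀ {m} {c v : Fin m → ℕ} n .{{_ : NonZero n}} →
                    Collinear (λ i → n * c i) v → Collinear c v
collinear-unscale {c = c} {v} n col i j = *-cancelˡ-≡ (c i * v j) (c j * v i) n (begin
  n * (c i * v j) ≡⟨ sym (*-assoc n (c i) (v j)) ⟩
  n * c i * v j   ≡⟨ col i j ⟩
  n * c j * v i   ≡⟨ *-assoc n (c j) (v i) ⟩
  n * (c j * v i) ∎)
  where open ≡-Reasoning

-- An injective encoding of words over Fin m as natural numbers (base-m digits,
-- shifted by one so that the empty word is distinguished).
code : ∀ {m} → List (Fin m) → ℕ
code []           = 0
code {m} (x ∷ xs) = suc (toℕ x + code xs * m)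

digits-injective : ∀ {n a b c d} .{{_ : NonZero n}} → a < n → b < n →
                   a + c * n ≡ b + d * n → a ≡ b × c ≡ d
digits-injective {n} {a} {b} {c} {d} a<n b<n e = a≡b , *-cancelʳ-≡ c d n (+-cancelˡ-≡ a _ _ e')
  where
  open ≡-Reasoning
  a≡b : a ≡ b
  a≡b = begin
    a               ≡⟨ sym (m<n⇒m%n≡m a<n) ⟩
    a % n           ≡⟨ sym ([m+kn]%n≡m%n a c n) ⟩
    (a + c * n) % n ≡⟨ cong (_% n) e ⟩
    (b + d * n) % n ≡⟨ [m+kn]%n≡m%n b d n ⟩
    b % n           ≡⟨ m<n⇒m%n≡m b<n ⟩
    b               ∎
  e' : a + c * n ≡ a + d * n
  e' = trans e (cong (_+ d * n) (sym a≡b))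

code-injective : ∀ {m} (xs ys : List (Fin m)) → code xs ≡ code ys → xs ≡ ys
code-injective []       []       _ = refl
code-injective {suc m} (x ∷ xs) (y ∷ ys) e
  with digits-injective (FinP.toℕ<n x) (FinP.toℕ<n y) (suc-injective e)
... | x≡y , xs≡ys = cong₂ _∷_ (FinP.toℕ-injective x≡y) (code-injective xs ys xs≡ys)

module _ {m : ℕ} where

  leastCodeShift : ∀ (w : List (Fin m)) → Σ ℕ λ a → a ≤ pred (length w) ×
                     (∀ b → b ≤ pred (length w) → code (rotate a w) ≤ code (rotate b w))
  leastCodeShift w = minimiser (λ a → code (rotate a w)) (pred (length w))

  canonShift : List (Fin m) → ℕ
  canonShift w = proj₁ (leastCodeShift w)

  canon : List (Fin m) → List (Fin m)
  canon w = rotate (canonShift w) w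

  canonShift≤length : ∀ w → canonShift w ≤ length w
  canonShift≤length w = ≤-trans (proj₁ (proj₂ (leastCodeShift w))) pred[n]≤n

  canon-minimal : ∀ w a → code (canon w) ≤ code (rotate a w)
  canon-minimal []           a = ≤-reflexive (cong code (sym (rotate-[] a)))
  canon-minimal w@(_ ∷ xs) a =
    subst (code (canon w) ≤_) (cong code (sym (rotate-mod a w)))
          (proj₂ (proj₂ (leastCodeShift w)) (a % length w) (≤-pred (m%n<n a (length w))))

  canon-rot1 : ∀ w → canon (rot1 w) ≡ canon w
  canon-rot1 []         = refl
  canon-rot1 w@(_ ∷ xs) = code-injective _ _ (≤-antisym rot1-below rot1-above)
    where
    c = canonShift w
    rot1-below : code (canon (rot1 w)) ≤ code (canon w)
    rot1-below = subst (code (canon (rot1 w)) ≤_)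
                       (cong code (trans (rotate-+ (length w) c w) (cong (rotate c) (rotate-length w))))
                       (canon-minimal (rot1 w) (length xs + c))
    rot1-above : code (canon w) ≤ code (canon (rot1 w))
    rot1-above = canon-minimal w (suc (canonShift (rot1 w)))

  canon-rotate : ∀ k w → canon (rotate k w) ≡ canon w
  canon-rotate zero    w = refl
  canon-rotate (suc k) w = trans (canon-rotate k (rot1 w)) (canon-rot1 w)

  canon-Rot1 : ∀ {w w'} → Rot1 w w' → canon w ≡ canon w'
  canon-Rot1 (x , xs , refl , refl) = sym (canon-rot1 (x ∷ xs))

  canon-rotate-canon : ∀ k w → canon (rotate k (canon w)) ≡ canon w
  canon-rotate-canon k w = trans (canon-rotate k (canon w)) (canon-rotate (canonShift w) w)

  length-rotate-canon : ∀ k w → length (rotate k (canon w)) ≡ length w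
  length-rotate-canon k w = trans (length-rotate k (canon w)) (length-rotate (canonShift w) w)

  canon-back : ∀ w → rotate (length w ∸ canonShift w) (canon w) ≡ w
  canon-back w = begin
    rotate (length w ∸ c) (rotate c w) ≡⟨ sym (rotate-+ c (length w ∸ c) w) ⟩
    rotate (c + (length w ∸ c)) w      ≡⟨ cong (λ k → rotate k w) (m+[n∸m]≡n (canonShift≤length w)) ⟩
    rotate (length w) w                ≡⟨ rotate-length w ⟩
    w                                  ∎
    where
    open ≡-Reasoning
    c = canonShift w

  offsetLeast : ∀ w → Σ ℕ (Least (λ s → rotate s (canon w) ≡ w))
  offsetLeast w = leastWitness (λ s → ≡-dec FinP._≟_ (rotate s (canon w)) w)
                                (length w ∸ canonShift w) (canon-back w)

  offset : List (Fin m) → ℕ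
  offset w = proj₁ (offsetLeast w)

  offset-spec : ∀ w → rotate (offset w) (canon w) ≡ w
  offset-spec w = proj₁ (proj₂ (offsetLeast w))

  offset-≤ : ∀ {w j} → rotate j (canon w) ≡ w → offset w ≤ j
  offset-≤ {w} {j} = least-≤ {j = j} (proj₂ (offsetLeast w))

  offset-period : ∀ w j → rotate j (canon w) ≡ w → Period w (j ∸ offset w)
  offset-period w j reach = begin
    rotate (j ∸ o) w                    ≡⟨ cong (rotate (j ∸ o)) (sym (offset-spec w)) ⟩
    rotate (j ∸ o) (rotate o (canon w)) ≡⟨ sym (rotate-+ o (j ∸ o) (canon w)) ⟩
    rotate (o + (j ∸ o)) (canon w)      ≡⟨ cong (λ i → rotate i (canon w)) (m+[n∸m]≡n (offset-≤ reach)) ⟩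
    rotate j (canon w)                  ≡⟨ reach ⟩
    w                                   ∎
    where
    open ≡-Reasoning
    o = offset w

  offset-+-period : ∀ w k → Period w k → rotate (offset w + k) (canon w) ≡ w
  offset-+-period w k per =
    trans (rotate-+ (offset w) k (canon w)) (trans (cong (rotate k) (offset-spec w)) per)

  offset-+-period< : ∀ w k → k < length w → Period w k → offset w + k < length w
  offset-+-period< w k k<N per = ≰⇒> λ N≤o+k →
    proj₂ (proj₂ (offsetLeast w)) (o + k ∸ N) (wrap<o N≤o+k) (wrap-reaches N≤o+k)
    where
    open ≡-Reasoning
    o = offset w
    N = length w
    wrap<o : N ≤ o + k → o + k ∸ N < o
    wrap<o N≤o+k = +-cancelʳ-< N (o + k ∸ N) o
      (subst (_< o + N) (sym (m∸n+n≡m N≤o+k)) (+-monoʳ-< o k<N))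
    wrap-reaches : N ≤ o + k → rotate (o + k ∸ N) (canon w) ≡ w
    wrap-reaches N≤o+k = begin
      rotate (o + k ∸ N) (canon w)               ≡⟨ cong (rotate (o + k ∸ N)) (sym canon-period-N) ⟩
      rotate (o + k ∸ N) (rotate N (canon w))    ≡⟨ sym (rotate-+ N (o + k ∸ N) (canon w)) ⟩
      rotate (N + (o + k ∸ N)) (canon w)         ≡⟨ cong (λ i → rotate i (canon w)) (m+[n∸m]≡n N≤o+k) ⟩
      rotate (o + k) (canon w)                   ≡⟨ offset-+-period w k per ⟩
      w                                          ∎
      where
      canon-period-N : Period (canon w) N
      canon-period-N = subst (Period (canon w)) (length-rotate-canon 0 w) (period-length (canon w))

module NecklaceFacts {m : ℕ} (v : Fin m → ℕ) where

  word : GoodWord v → List (Fin m)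
  word = proj₁

  _~_ : GoodWord v → GoodWord v → Set
  _~_ = _≈_ (Necklaces v)

  open IsEquivalence (isEq (Necklaces v)) public using () renaming (sym to ~-sym; trans to ~-trans)

  rotateGood : ℕ → GoodWord v → GoodWord v
  rotateGood k (w , nonempty , col) =
    rotate k w , subst (0 <_) (sym (length-rotate k w)) nonempty , collinear-≗ (count-rotate k w) col

  canon-~ : ∀ {a b} → a ~ b → canon (word a) ≡ canon (word b)
  canon-~ a~b = EqClosure.gfold (isEquivalence {A = List (Fin m)}) (canon ∘ word) canon-Rot1 a~b

  shift-~ : ∀ a b → word b ≡ rot1 (word a) → a ~ b
  shift-~ (x ∷ xs , _) b b≡ = EqClosure.return (x , xs , refl , b≡)

  same-word-~ : ∀ {a b} → word a ≡ word b → a ~ b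
  same-word-~ {a} {b} a≡b = ~-trans
    (shift-~ a (rotateGood 1 a) refl)
    (~-sym (shift-~ b (rotateGood 1 a) (cong rot1 a≡b)))

  rotate-~ : ∀ k a → a ~ rotateGood k a
  rotate-~ zero    a = same-word-~ refl
  rotate-~ (suc k) a = ~-trans (shift-~ a (rotateGood 1 a) refl)
                         (~-trans (rotate-~ k (rotateGood 1 a)) (same-word-~ refl))

  canonGood : GoodWord v → GoodWord v
  canonGood a = rotateGood (canonShift (word a)) a

PeriodicWords : ∀ {m} → (Fin m → ℕ) → Class
PeriodicWords v = record
  { Obj  = Σ (GoodWord v) λ a → Σ ℕ λ k → k < length (proj₁ a) × Period (proj₁ a) k
  ; _≈_  = λ { (a , k , _) (b , l , _) → proj₁ a ≡ proj₁ b × k ≡ l }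
  ; isEq = record
      { refl  = refl , refl
      ; sym   = λ { (p , q) → sym p , sym q }
      ; trans = λ { (p , q) (p' , q') → trans p p' , trans q q' }
      }
  ; size = λ { (a , _) → length (proj₁ a) }
  }

module PointedNecklaces {m : ℕ} (v : Fin m → ℕ) where
  open NecklaceFacts v

  toPeriodic : Obj (Θ (Necklaces v)) → Obj (PeriodicWords v)
  toPeriodic (a , i , i<N) = t , i ∸ offset (word t) , k<N , offset-period (word t) i reach
    where
    t = rotateGood i (canonGood a)
    reach : rotate i (canon (word t)) ≡ word t
    reach = cong (rotate i) (canon-rotate-canon i (word a))
    k<N : i ∸ offset (word t) < length (word t)
    k<N = ≤-<-trans (m∸n≤m i (offset (word t))) (subst (i <_) (sym (length-rotate-canon i (word a))) i<N)

  fromPeriodic : Obj (PeriodicWords v) → Obj (Θ (Necklaces v))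
  fromPeriodic (b , k , k<N , per) = b , offset (word b) + k , offset-+-period< (word b) k k<N per

  -- Equivalent pointed necklaces share their canonical word, hence their image.
  toPeriodic-cong : ∀ {x y} → _≈_ (Θ (Necklaces v)) x y → _≈_ (PeriodicWords v) (toPeriodic x) (toPeriodic y)
  toPeriodic-cong {a , i , _} (a~b , refl) =
    cong (rotate i) same-canon , cong (λ c → i ∸ offset (rotate i c)) same-canon
    where same-canon = canon-~ a~b

  fromPeriodic-cong : ∀ {x y} → _≈_ (PeriodicWords v) x y → _≈_ (Θ (Necklaces v)) (fromPeriodic x) (fromPeriodic y)
  fromPeriodic-cong {_ , k , _} (a≡b , refl) = same-word-~ a≡b , cong (λ w → offset w + k) a≡b

  -- Reading from offset t + k returns t since k is a period, and the recovered
  -- period is (offset t + k) − offset t = k.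
  to∘fromPeriodic : ∀ y → _≈_ (PeriodicWords v) (toPeriodic (fromPeriodic y)) y
  to∘fromPeriodic (b , k , k<N , per) =
    returns , trans (cong (λ t → offset (word b) + k ∸ offset t) returns) (m+n∸m≡n (offset (word b)) k)
    where returns = offset-+-period (word b) k per

  -- t is a rotation of a, and offset t + (i − offset t) = i.
  from∘toPeriodic : ∀ x → _≈_ (Θ (Necklaces v)) (fromPeriodic (toPeriodic x)) x
  from∘toPeriodic (a , i , i<N) =
    ~-sym (~-trans (rotate-~ (canonShift (word a)) a) (rotate-~ i (canonGood a)))
    , m+[n∸m]≡n (offset-≤ (cong (rotate i) (canon-rotate-canon i (word a))))

  pointed≅periodic : Θ (Necklaces v) ≅ PeriodicWords v
  pointed≅periodic = mkIso (Θ (Necklaces v)) (PeriodicWords v) toPeriodic fromPeriodic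
    (λ {x} {y} → toPeriodic-cong {x} {y}) (λ {x} {y} → fromPeriodic-cong {x} {y})
    to∘fromPeriodic from∘toPeriodic
    (λ { (a , i , _) → length-rotate-canon i (word a) })

positive-factor : ∀ a b {c} → a * b ≡ c → 0 < c → 0 < a
positive-factor zero    b refl ()
positive-factor (suc a) b _    _  = z<s

module PeriodDecomposition {A : Set} (w : List A) (k : ℕ) (k<N : k < length w) (per : Period w k) where
  N = length w
  k′ = N ∸ k
  g = gcd k′ N
  n = _∣_.quotient (gcd[m,n]∣n k′ N)
  j = _∣_.quotient (gcd[m,n]∣m k′ N)
  root = take g w

  N≡n*g : N ≡ n * g
  N≡n*g = _∣_.equality (gcd[m,n]∣n k′ N)

  k′≡j*g : k′ ≡ j * g
  k′≡j*g = _∣_.equality (gcd[m,n]∣m k′ N)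

  N>0 : 0 < N
  N>0 = ≤-<-trans z≤n k<N

  g>0 : 0 < g
  g>0 = n≢0⇒n>0 λ g≡0 → n>0⇒n≢0 N>0 (gcd[m,n]≡0⇒n≡0 k′ g≡0)

  instance
    g≢0 : NonZero g
    g≢0 = >-nonZero g>0

  n>0 : 0 < n
  n>0 = positive-factor n g (sym N≡n*g) N>0

  j>0 : 0 < j
  j>0 = positive-factor j g (sym k′≡j*g) (m<n⇒0<n∸m k<N)

  j≤n : j ≤ n
  j≤n = *-cancelʳ-≤ j n g (subst₂ _≤_ k′≡j*g N≡n*g (m∸n≤m N k))

  j-coprime : gcd j n ≡ 1
  j-coprime = *-cancelˡ-≡ (gcd j n) 1 g (begin
    g * gcd j n           ≡⟨ c*gcd[m,n]≡gcd[cm,cn] g j n ⟩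
    gcd (g * j) (g * n)   ≡⟨ cong₂ gcd (trans (*-comm g j) (sym k′≡j*g)) (trans (*-comm g n) (sym N≡n*g)) ⟩
    g                     ≡⟨ sym (*-identityʳ g) ⟩
    g * 1                 ∎)
    where open ≡-Reasoning

  root-length : length root ≡ g
  root-length = trans (length-take g w) (m≤n⇒m⊓n≡m (∣⇒≤ {{>-nonZero N>0}} (gcd[m,n]∣n k′ N)))

  -- Both N − k and N are periods, hence so is g.
  w≡power : w ≡ power n root
  w≡power = periodic⇒power n g w (period-gcd k′ N k′-period (period-length w)) (sym N≡n*g)
    where
    k′-period : Period w k′
    k′-period = period-∸ (<⇒≤ k<N) (period-length w) per

  k≡[n∸j]*g : (n ∸ j) * length root ≡ k
  k≡[n∸j]*g = begin
    (n ∸ j) * length root ≡⟨ cong ((n ∸ j) *_) root-length ⟩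
    (n ∸ j) * g           ≡⟨ *-distribʳ-∸ g n j ⟩
    n * g ∸ j * g         ≡⟨ cong₂ _∸_ (sym N≡n*g) (sym k′≡j*g) ⟩
    N ∸ (N ∸ k)           ≡⟨ m∸[m∸n]≡n (<⇒≤ k<N) ⟩
    k                     ∎
    where open ≡-Reasoning

power-period< : ∀ {A : Set} n j (u : List A) → 0 < j → j ≤ n → 0 < length u →
                (n ∸ j) * length u < length (power n u)
power-period< n j u j>0 j≤n u>0 = subst ((n ∸ j) * length u <_) (sym (length-power n u))
  (*-monoˡ-< (length u) {{>-nonZero u>0}} (∸-monoʳ-< j>0 j≤n))

Totative : ℕ → ℕ → Set
Totative n j = 0 < j × j ≤ n × gcd j n ≡ 1

-- Triples (n, j, u) of a positive exponent n, a totative j of n and a good word u,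
-- of size n·|u|: the word uⁿ labelled by j.
TotativePowers : ∀ {m} → (Fin m → ℕ) → Class
TotativePowers v = record
  { Obj  = Σ ℕ λ n → 0 < n × Σ ℕ (Totative n) × GoodWord v
  ; _≈_  = λ { (n , _ , (j , _) , u) (n' , _ , (j' , _) , u') → n ≡ n' × j ≡ j' × proj₁ u ≡ proj₁ u' }
  ; isEq = record
      { refl  = refl , refl , refl
      ; sym   = λ { (p , q , r) → sym p , sym q , sym r }
      ; trans = λ { (p , q , r) (p' , q' , r') → trans p p' , trans q q' , trans r r' }
      }
  ; size = λ { (n , _ , _ , u) → n * length (proj₁ u) }
  }

module PeriodicPowers {m : ℕ} (v : Fin m → ℕ) where

  -- Decompose as in PeriodDecomposition; the root is good since the letter
  -- counts of w are n times those of the root.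
  toPowers : Obj (PeriodicWords v) → Obj (TotativePowers v)
  toPowers ((w , _ , col) , k , k<N , per) =
    n , n>0 , (j , j>0 , j≤n , j-coprime) , (root , subst (0 <_) (sym root-length) g>0 , root-col)
    where
    open PeriodDecomposition w k k<N per
    root-col : Collinear (count root) v
    root-col = collinear-unscale n {{>-nonZero n>0}} (collinear-≗ count-w col)
      where
      count-w : ∀ i → n * count root i ≡ count w i
      count-w i = trans (sym (count-power n root i)) (cong (λ x → count x i) (sym w≡power))

  fromPowers : Obj (TotativePowers v) → Obj (PeriodicWords v)
  fromPowers (n , n>0 , (j , j>0 , j≤n , _) , (u , u>0 , col)) =
    (power n u , nonempty , collinear-≗ (count-power n u) (collinear-scale n col))
    , (n ∸ j) * length u , power-period< n j u j>0 j≤n u>0 , period-* (n ∸ j) (period-power n u)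
    where
    nonempty : 0 < length (power n u)
    nonempty = subst (0 <_) (sym (length-power n u)) (*-mono-< n>0 u>0)

  toPowers-cong : ∀ {x y} → _≈_ (PeriodicWords v) x y → _≈_ (TotativePowers v) (toPowers x) (toPowers y)
  toPowers-cong {(w , _) , k , _} {(.w , _) , .k , _} (refl , refl) = refl , refl , refl

  fromPowers-cong : ∀ {x y} → _≈_ (TotativePowers v) x y → _≈_ (PeriodicWords v) (fromPowers x) (fromPowers y)
  fromPowers-cong {n , _ , (j , _) , (u , _)} {.n , _ , (.j , _) , (.u , _)} (refl , refl , refl) = refl , refl

  -- Decomposing uⁿ at its period (n − j)·|u| recovers g = |u|, hence n, j and u.
  to∘fromPowers : ∀ y → _≈_ (TotativePowers v) (toPowers (fromPowers y)) y
  to∘fromPowers (n , n>0 , (j , j>0 , j≤n , j-cop) , (u , u>0 , _)) =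
    *-cancelʳ-≡ n′ n L (trans (sym (subst (λ d → N ≡ n′ * d) g≡L N≡n*g)) (length-power n u))
    , *-cancelʳ-≡ j′ j L (trans (sym (subst (λ d → k′ ≡ j′ * d) g≡L k′≡j*g)) k′≡j*L)
    , trans (cong (λ d → take d (power n u)) g≡L) (take-power n u n>0)
    where
    L = length u
    instance
      L≢0 : NonZero L
      L≢0 = >-nonZero u>0
    open PeriodDecomposition (power n u) ((n ∸ j) * L) (power-period< n j u j>0 j≤n u>0)
                             (period-* (n ∸ j) (period-power n u))
      using (N; k′; g; N≡n*g; k′≡j*g) renaming (n to n′; j to j′)
    open ≡-Reasoning
    k′≡j*L : k′ ≡ j * L
    k′≡j*L = begin
      length (power n u) ∸ (n ∸ j) * L ≡⟨ cong (_∸ (n ∸ j) * L) (length-power n u) ⟩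
      n * L ∸ (n ∸ j) * L              ≡⟨ sym (*-distribʳ-∸ L n (n ∸ j)) ⟩
      (n ∸ (n ∸ j)) * L                ≡⟨ cong (_* L) (m∸[m∸n]≡n j≤n) ⟩
      j * L                            ∎
    g≡L : g ≡ L
    g≡L = begin
      gcd k′ N             ≡⟨ cong₂ gcd (trans k′≡j*L (*-comm j L)) (trans (length-power n u) (*-comm n L)) ⟩
      gcd (L * j) (L * n)  ≡⟨ sym (c*gcd[m,n]≡gcd[cm,cn] L j n) ⟩
      L * gcd j n          ≡⟨ cong (L *_) j-cop ⟩
      L * 1                ≡⟨ *-identityʳ L ⟩
      L                    ∎

  from∘toPowers : ∀ x → _≈_ (PeriodicWords v) (fromPowers (toPowers x)) x
  from∘toPowers ((w , _) , k , k<N , per) = sym w≡power , k≡[n∸j]*g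
    where open PeriodDecomposition w k k<N per

  periodic≅powers : PeriodicWords v ≅ TotativePowers v
  periodic≅powers = mkIso (PeriodicWords v) (TotativePowers v) toPowers fromPowers
    (λ {x} {y} → toPowers-cong {x} {y}) (λ {x} {y} → fromPowers-cong {x} {y})
    to∘fromPowers from∘toPowers
    (λ { ((w , _) , k , k<N , per) → let open PeriodDecomposition w k k<N per in
                                     trans (cong (n *_) root-length) (sym N≡n*g) })

lookup-injective : ∀ {A : Set} {xs : List A} → Unique xs → ∀ a b → lookup xs a ≡ lookup xs b → a ≡ b
lookup-injective (_ ∷ _)        Fin.zero    Fin.zero    _ = refl
lookup-injective (x∉xs ∷ _)     Fin.zero    (Fin.suc b) e = ⊥-elim (All.lookup x∉xs (∈-lookup b) e)
lookup-injective (x∉xs ∷ _)     (Fin.suc a) Fin.zero    e = ⊥-elim (All.lookup x∉xs (∈-lookup a) (sym e))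
lookup-injective (_ ∷ distinct) (Fin.suc a) (Fin.suc b) e = cong Fin.suc (lookup-injective distinct a b e)

totatives : ℕ → List ℕ
totatives n = filter (λ k → gcd k n ≟ 1) (applyUpTo suc n)

totatives-unique : ∀ n → Unique (totatives n)
totatives-unique n = Unique.filter⁺ (λ k → gcd k n ≟ 1)
  (Unique.applyUpTo⁺₁ suc n (λ i<j _ e → <⇒≢ i<j (suc-injective e)))

totativeAt : ∀ n → Fin (φ n) → ℕ
totativeAt n = lookup (totatives n)

totativeAt-totative : ∀ n i → Totative n (totativeAt n i)
totativeAt-totative n i with ∈-filter⁻ (λ k → gcd k n ≟ 1) (∈-lookup {xs = totatives n} i)
... | listed , coprime with ∈-applyUpTo⁻ suc listed
...   | _ , j<n , e = subst (0 <_) (sym e) z<s , subst (_≤ n) (sym e) j<n , coprime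

totativeIndex : ∀ n j → Totative n j → Fin (φ n)
totativeIndex n (suc j) (_ , j<n , coprime) =
  Any.index (∈-filter⁺ (λ k → gcd k n ≟ 1) (∈-applyUpTo⁺ suc j<n) coprime)

totativeAt-index : ∀ n j (t : Totative n j) → totativeAt n (totativeIndex n j t) ≡ j
totativeAt-index n (suc j) (_ , j<n , coprime) =
  sym (lookup-index (∈-filter⁺ (λ k → gcd k n ≟ 1) (∈-applyUpTo⁺ suc j<n) coprime))

totativeIndex-unique : ∀ n i j (t : Totative n j) → totativeAt n i ≡ j → totativeIndex n j t ≡ i
totativeIndex-unique n i j t at-i≡j =
  lookup-injective (totatives-unique n) _ _ (trans (totativeAt-index n j t) (sym at-i≡j))

module TotativeCopies {m : ℕ} (v : Fin m → ℕ) where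

  Copies : Class
  Copies = SumPos (λ n → copies (φ n) (Rep n (Words v)))

  -- Only the label changes; the size n·|u| is the size of Rep n.
  toCopies : Obj (TotativePowers v) → Obj Copies
  toCopies (n , n>0 , (j , t) , u) = n , n>0 , (totativeIndex n j t , u)

  fromCopies : Obj Copies → Obj (TotativePowers v)
  fromCopies (n , n>0 , (i , u)) = n , n>0 , (totativeAt n i , totativeAt-totative n i) , u

  toCopies-cong : ∀ {x y} → _≈_ (TotativePowers v) x y → _≈_ Copies (toCopies x) (toCopies y)
  toCopies-cong {n , _ , (j , t) , _} {.n , _ , (.j , t′) , _} (refl , refl , u≡u′) =
    inj (totativeIndex-unique n _ j t (totativeAt-index n j t′) , u≡u′)

  fromCopies-cong : ∀ {x y} → _≈_ Copies x y → _≈_ (TotativePowers v) (fromCopies x) (fromCopies y)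
  fromCopies-cong (inj (refl , u≡u′)) = refl , refl , u≡u′

  to∘fromCopies : ∀ y → _≈_ Copies (toCopies (fromCopies y)) y
  to∘fromCopies (n , _ , (i , _)) = inj (totativeIndex-unique n i _ (totativeAt-totative n i) refl , refl)

  from∘toCopies : ∀ x → _≈_ (TotativePowers v) (fromCopies (toCopies x)) x
  from∘toCopies (n , _ , (j , t) , _) = refl , totativeAt-index n j t , refl

  powers≅copies : TotativePowers v ≅ Copies
  powers≅copies = mkIso (TotativePowers v) Copies toCopies fromCopies
    (λ {x} {y} → toCopies-cong {x} {y}) fromCopies-cong to∘fromCopies from∘toCopies (λ _ → refl)

-- Main theorem: pointed necklaces with counts collinear to v decompose as
-- Σ_{n>0} φ(n) Rep_n(S_v), via pointed necklaces ≅ periodic words ≅ totative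
-- powers ≅ copies.
mainTheorem7 : ∀ {m : ℕ} (v : Fin m → ℕ) → (∀ i → 0 < v i) →
    Θ (Necklaces v) ≅ SumPos (λ n → copies (φ n) (Rep n (Words v)))
mainTheorem7 v _ =
  ≅-trans (Θ (Necklaces v)) (PeriodicWords v) (Copies v) (pointed≅periodic v)
    (≅-trans (PeriodicWords v) (TotativePowers v) (Copies v) (periodic≅powers v) (powers≅copies v))
  where
  open PointedNecklaces using (pointed≅periodic)
  open PeriodicPowers using (periodic≅powers)
  open TotativeCopies using (Copies; powers≅copies)
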